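{- Let $n_1,n_2\in\mathbb N$ and $r\ge2$ be integers, and let $\alpha_1,\alpha_2\in\{0,\dots,r-2\}$ be the residues of $n_1$ and $n_2$ modulo $r-1$. Then \[ f(n_1+n_2,r)-f(n_1,r)-f(n_2,r)-2\cdot\frac{r-2}{r-1}\cdot n_1n_2= \begin{cases} 2\cdot\dfrac{\alpha_1\alpha_2}{r-1}, & \alpha_1+\alpha_2<r-1,\\[6pt] 2\cdot\dfrac{(r-1-\alpha_1)(r-1-\alpha_2)}{r-1}, & \alpha_1+\alpha_2\ge r-1. \end{cases} \]
   Context: $T_{n,r}$ is the Turán graph: the complete $(r-1)$-partite graph on $n$ vertices with part sizes differing by at most one, and $f(n,r)=2|E(T_{n,r})|$ (twice the maximum number of edges of a $K_r$-free $n$-vertex graph). -}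

module Defs where

open import Data.Nat using (ℕ; zero; suc; s≤s; _+_; _*_; _∸_; _≤_; _<_; _≟_; _<?_; NonZero)
open import Data.Nat.DivMod using (_%_)
open import Data.Fin using (Fin; toℕ)
open import Data.List using (List; []; _∷_; length; filter; concatMap; allFin)
open import Data.Product using (_×_; _,_; proj₁; proj₂)
open import Relation.Binary.PropositionalEquality using (_≡_)
open import Relation.Nullary using (Dec; ¬_; yes; no)
open import Relation.Nullary using (¬?)
open import Relation.Nullary.Decidable using (_×-dec_)

-- Part index of a vertex x in a balanced partition into m classes
-- (classes = residues mod m; class sizes differ by at most one).
-- For m = 0 (only arises when r ≤ 1) the value is irrelevant.
part : ℕ → ℕ → ℕ
part zero    x = 0
part (suc k) x = x % suc k

TuranAdj : (n r : ℕ) → Fin n → Fin n → Set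
TuranAdj n r i j = ¬ (part (r ∸ 1) (toℕ i) ≡ part (r ∸ 1) (toℕ j))

TuranAdj? : (n r : ℕ) → (i j : Fin n) → Dec (TuranAdj n r i j)
TuranAdj? n r i j = ¬? (part (r ∸ 1) (toℕ i) ≟ part (r ∸ 1) (toℕ j))

-- Edge set of T_{n,r}: unordered pairs {i,j}, listed once as (i,j) with i < j.
TuranEdges : (n r : ℕ) → List (Fin n × Fin n)
TuranEdges n r =
  filter (λ p → (toℕ (proj₁ p) <? toℕ (proj₂ p)) ×-dec TuranAdj? n r (proj₁ p) (proj₂ p))
         (concatMap (λ i → Data.List.map (λ j → (i , j)) (allFin n)) (allFin n))

f : ℕ → ℕ → ℕ
f n r = 2 * length (TuranEdges n r)

r∸1-nonZero : ∀ {r} → 2 ≤ r → NonZero (r ∸ 1)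
r∸1-nonZero {suc (suc k)} _ = _
r∸1-nonZero {suc zero} (s≤s ())

-- Put vertex j of T_{n,r} into class j mod m, where m = r - 1.  Adding
-- vertex n creates n - ⌊n/m⌋ new edges, because the earlier vertices of
-- its class are exactly the ⌊n/m⌋ numbers j < n with j ≡ n.  Induction
-- gives m·f(n) = (m - 1)·n² - a·(m - a) with a = n mod m, so m times the
-- left-hand side is the change a₁b₁ + a₂b₂ - a₁₂b₁₂ of the deficit
-- a·b, where bᵢ = m - aᵢ.  If a₁ + a₂ < m then a₁₂ = a₁ + a₂ and the
-- change is 2a₁a₂; otherwise b₁₂ = b₁ + b₂, which is the same situation
-- with the roles of a and b exchanged, and the change is 2b₁b₂.
module Submission where

open import Data.Fin.Base using (Fin; toℕ)
import Data.Integer.Base as ℤ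
open import Data.Integer.Properties using (pos-*) renaming (*-identityʳ to ℤ-*-identityʳ)
import Data.Integer.Tactic.RingSolver as ℤ-Solver
open import Data.List.Base
  using (List; []; _∷_; _++_; [_]; length; map; filter; concatMap; allFin; upTo; applyUpTo; tabulate)
open import Data.List.Properties
  using (length-++; filter-++; filter-none; filter-all; map-++; map-cong; map-∘; map-tabulate;
         applyUpTo-∷ʳ; length-applyUpTo; ++-assoc; ++-identityʳ)
open import Data.List.Relation.Unary.All using (All; []; _∷_)
open import Data.List.Relation.Unary.All.Properties using (applyUpTo⁺₁; applyUpTo⁺₂)
open import Data.Nat.Base using (ℕ; zero; suc; _+_; _*_; _∸_; _<_; _≤_; s≤s; z≤n; s≤s⁻¹; NonZero)
import Data.Nat.Base as ℕ
open import Data.Nat.DivMod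
  using (_%_; %-distribˡ-+; [m+n]%n≡m%n; [m+kn]%n≡m%n; m<n⇒m%n≡m; m%n<n; m≡m%n+[m/n]*n)
open import Data.Nat.ListAction using (sum)
open import Data.Nat.ListAction.Properties using (sum-++)
open import Data.Nat.Properties
  using (+-commutativeSemigroup; _≟_; _<?_; +-suc; +-identityʳ; +-comm; +-assoc; *-comm; *-zeroʳ;
         +-cancelˡ-≡; +-cancelʳ-≡; ≤-refl; <-trans; <⇒≤; <⇒≢; <⇒≱; +-mono-<; m≤n⇒m<n∨m≡n;
         m+[n∸m]≡n; m∸n+n≡m; m<n+o⇒m∸n<o)
open import Data.Nat.Tactic.RingSolver using (solve-∀)
open import Algebra.Properties.CommutativeSemigroup +-commutativeSemigroup
  using () renaming (interchange to +-interchange)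
open import Data.Product.Base using (_×_; _,_; proj₂)
open import Data.Rational.Base using (ℚ; _/_; _-_; 0ℚ; toℚᵘ) renaming (_+_ to _+ℚ_; _*_ to _*ℚ_)
open import Data.Rational.Properties
  using (toℚᵘ-injective; toℚᵘ-fromℚᵘ; toℚᵘ-homo-+; toℚᵘ-homo-*; +-*-commutativeRing)
  renaming (_≟_ to _≟ℚ_)
open import Data.Rational.Unnormalised.Base using (mkℚᵘ; *≡*)
  renaming (_≃_ to _≃ᵘ_; _+_ to _+ᵘ_; _*_ to _*ᵘ_)
open import Data.Rational.Unnormalised.Properties using (module ≃-Reasoning)
  renaming (+-cong to +ᵘ-cong; *-cong to *ᵘ-cong)
open import Data.Sum.Base using (inj₁; inj₂)
open import Function.Base using (_∘_; _∘′_; id)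
open import Function.Bundles using (_⇔_; Equivalence; mk⇔)
open import Level using (Level; 0ℓ)
open import Relation.Binary.Core using (REL)
open import Relation.Binary.PropositionalEquality
  using (_≡_; _≢_; refl; sym; trans; cong; cong₂; subst; module ≡-Reasoning)
open import Relation.Nullary using (Dec; yes; no; ¬?; contradiction)
open import Relation.Nullary.Decidable using (_×-dec_; dec⇒maybe)
open import Relation.Unary using (Pred; Decidable; ∁)
import Tactic.RingSolver as ℚ-Solver
open import Tactic.RingSolver.Core.AlmostCommutativeRing using (AlmostCommutativeRing; fromCommutativeRing)

open import Defs

private
  variable
    a b p q r : Level
    A : Set a

count : {P : Pred A p} → Decidable P → List A → ℕ
count P? xs = length (filter P? xs)

module _ {P : Pred A p} (P? : Decidable P) where

  count-++ : ∀ xs ys → count P? (xs ++ ys) ≡ count P? xs + count P? ys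
  count-++ xs ys = trans (cong length (filter-++ P? xs ys)) (length-++ (filter P? xs))

  count-map : ∀ {B : Set b} (f : B → A) xs → count P? (map f xs) ≡ count (λ x → P? (f x)) xs
  count-map f []       = refl
  count-map f (x ∷ xs) with P? (f x)
  ... | yes _ = cong suc (count-map f xs)
  ... | no  _ = count-map f xs

  count-concatMap : ∀ {B : Set b} (g : B → List A) xs →
                    count P? (concatMap g xs) ≡ sum (map (count P? ∘ g) xs)
  count-concatMap g []       = refl
  count-concatMap g (x ∷ xs) =
    trans (count-++ (g x) (concatMap g xs)) (cong (count P? (g x) +_) (count-concatMap g xs))

  count-none : ∀ {xs} → All (∁ P) xs → count P? xs ≡ 0
  count-none ¬Pxs = cong length (filter-none P? ¬Pxs)

  count-all : ∀ {xs} → All P xs → count P? xs ≡ length xs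
  count-all Pxs = cong length (filter-all P? Pxs)

  count-∁+count≡length : ∀ xs → count (¬? ∘ P?) xs + count P? xs ≡ length xs
  count-∁+count≡length []       = refl
  count-∁+count≡length (x ∷ xs) with P? x
  ... | yes _ = trans (+-suc _ _) (cong suc (count-∁+count≡length xs))
  ... | no  _ = cong suc (count-∁+count≡length xs)

count-cong : {P : Pred A p} {Q : Pred A q} (P? : Decidable P) (Q? : Decidable Q) →
             ∀ {xs} → All (λ x → P x ⇔ Q x) xs → count P? xs ≡ count Q? xs
count-cong P? Q? []                      = refl
count-cong P? Q? {x ∷ _} (P⇔Q ∷ Ps⇔Qs) with P? x | Q? x
... | yes _  | yes _  = cong suc (count-cong P? Q? Ps⇔Qs)
... | no _   | no _   = count-cong P? Q? Ps⇔Qs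
... | yes Px | no ¬Qx = contradiction (Equivalence.to P⇔Q Px) ¬Qx
... | no ¬Px | yes Qx = contradiction (Equivalence.from P⇔Q Qx) ¬Px

sum-count-singleton : ∀ {B : Set b} {R : REL B A r} (R? : ∀ x y → Dec (R x y)) y xs →
                      sum (map (λ x → count (R? x) [ y ]) xs) ≡ count (λ x → R? x y) xs
sum-count-singleton R? y []       = refl
sum-count-singleton R? y (x ∷ xs) with R? x y
... | yes _ = cong suc (sum-count-singleton R? y xs)
... | no  _ = sum-count-singleton R? y xs

sum-map-+ : ∀ (f g : A → ℕ) xs → sum (map (λ x → f x + g x) xs) ≡ sum (map f xs) + sum (map g xs)
sum-map-+ f g []       = refl
sum-map-+ f g (x ∷ xs) =
  trans (cong (f x + g x +_) (sum-map-+ f g xs)) (+-interchange (f x) (g x) _ _)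

upTo-suc : ∀ n → upTo (suc n) ≡ upTo n ++ [ n ]
upTo-suc n = sym (applyUpTo-∷ʳ id n)

upTo-+ : ∀ d n → upTo (d + n) ≡ upTo d ++ map (d +_) (upTo n)
upTo-+ d zero    = trans (cong upTo (+-identityʳ d)) (sym (++-identityʳ (upTo d)))
upTo-+ d (suc n) = begin
  upTo (d + suc n)                             ≡⟨ cong upTo (+-suc d n) ⟩
  upTo (suc (d + n))                           ≡⟨ upTo-suc (d + n) ⟩
  upTo (d + n) ++ [ d + n ]                    ≡⟨ cong (_++ [ d + n ]) (upTo-+ d n) ⟩
  (upTo d ++ map (d +_) (upTo n)) ++ [ d + n ] ≡⟨ ++-assoc (upTo d) _ _ ⟩
  upTo d ++ (map (d +_) (upTo n) ++ [ d + n ]) ≡⟨ cong (upTo d ++_) (map-++ (d +_) (upTo n) [ n ]) ⟨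
  upTo d ++ map (d +_) (upTo n ++ [ n ])       ≡⟨ cong (λ is → upTo d ++ map (d +_) is) (upTo-suc n) ⟨
  upTo d ++ map (d +_) (upTo (suc n))          ∎
  where open ≡-Reasoning

tabulate-toℕ : ∀ (f : ℕ → A) n → tabulate {n = n} (f ∘ toℕ) ≡ applyUpTo f n
tabulate-toℕ f zero    = refl
tabulate-toℕ f (suc n) = cong (f 0 ∷_) (tabulate-toℕ (f ∘ suc) n)

map-toℕ-allFin : ∀ n → map toℕ (allFin n) ≡ upTo n
map-toℕ-allFin n = trans (map-tabulate id toℕ) (tabulate-toℕ id n)

count-upTo-suc : {P : Pred ℕ p} (P? : Decidable P) (n : ℕ) →
                 count P? (upTo (suc n)) ≡ count P? (upTo n) + count P? [ n ]
count-upTo-suc P? n = trans (cong (count P?) (upTo-suc n)) (count-++ P? (upTo n) [ n ])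

count-≟-upTo : ∀ {c n} → c < n → count (_≟ c) (upTo n) ≡ 1
count-≟-upTo {c} {suc n} c<1+n with m≤n⇒m<n∨m≡n (s≤s⁻¹ c<1+n)
... | inj₁ c<n  = trans (count-upTo-suc (_≟ c) n)
  (cong₂ _+_ (count-≟-upTo c<n) (count-none (_≟ c) ((λ n≡c → <⇒≢ c<n (sym n≡c)) ∷ [])))
... | inj₂ refl = trans (count-upTo-suc (_≟ c) n)
  (cong₂ _+_ (count-none (_≟ c) (applyUpTo⁺₁ id c <⇒≢)) (count-all (_≟ c) (refl ∷ [])))

countPairs< : {R : REL ℕ ℕ r} → (∀ i j → Dec (R i j)) → ℕ → ℕ
countPairs< R? n = sum (map (λ i → count (λ j → (i <? j) ×-dec R? i j) (upTo n)) (upTo n))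

countPairs<-suc : {R : REL ℕ ℕ r} (R? : ∀ i j → Dec (R i j)) (n : ℕ) →
                  countPairs< R? (suc n) ≡ countPairs< R? n + count (λ i → R? i n) (upTo n)
countPairs<-suc R? n = begin
    sum (map row′ (upTo (suc n)))
  ≡⟨ cong (sum ∘ map row′) (upTo-suc n) ⟩
    sum (map row′ (upTo n ++ [ n ]))
  ≡⟨ trans (cong sum (map-++ row′ (upTo n) [ n ])) (sum-++ (map row′ (upTo n)) [ row′ n ]) ⟩
    sum (map row′ (upTo n)) + (row′ n + 0)
  ≡⟨ cong₂ _+_ (cong sum (map-cong (λ i → count-upTo-suc (R<? i) n) (upTo n))) (cong (_+ 0) row′-n) ⟩
    sum (map (λ i → row i + count (R<? i) [ n ]) (upTo n)) + 0
  ≡⟨ trans (+-identityʳ _) (sum-map-+ row (λ i → count (R<? i) [ n ]) (upTo n)) ⟩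
    countPairs< R? n + sum (map (λ i → count (R<? i) [ n ]) (upTo n))
  ≡⟨ cong (countPairs< R? n +_) (trans (sum-count-singleton R<? n (upTo n)) drop-<) ⟩
    countPairs< R? n + count (λ i → R? i n) (upTo n)
  ∎
  where
  open ≡-Reasoning
  R<? : ∀ i j → Dec (i < j × _)
  R<? i j = (i <? j) ×-dec R? i j
  row row′ : ℕ → ℕ
  row  i = count (R<? i) (upTo n)
  row′ i = count (R<? i) (upTo (suc n))
  row′-n : row′ n ≡ 0
  row′-n = count-none (R<? n) (applyUpTo⁺₁ id (suc n) (λ j≤n (n<j , _) → <⇒≱ n<j (s≤s⁻¹ j≤n)))
  drop-< : count (λ i → R<? i n) (upTo n) ≡ count (λ i → R? i n) (upTo n)
  drop-< = count-cong _ _ (applyUpTo⁺₁ id n (λ i<n → mk⇔ proj₂ (i<n ,_)))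

length-TuranEdges : ∀ n r →
  length (TuranEdges n r) ≡ countPairs< (λ i j → ¬? (part (r ∸ 1) i ≟ part (r ∸ 1) j)) n
length-TuranEdges n r = begin
    length (TuranEdges n r)
  ≡⟨ count-concatMap E? (λ i → map (i ,_) (allFin n)) (allFin n) ⟩
    sum (map (λ i → count E? (map (i ,_) (allFin n))) (allFin n))
  ≡⟨ cong sum (map-cong row (allFin n)) ⟩
    sum (map (λ i → count (R<? (toℕ i)) (upTo n)) (allFin n))
  ≡⟨ cong sum (map-∘ (allFin n)) ⟩
    sum (map (λ i → count (R<? i) (upTo n)) (map toℕ (allFin n)))
  ≡⟨ cong (λ is → sum (map (λ i → count (R<? i) (upTo n)) is)) (map-toℕ-allFin n) ⟩
    sum (map (λ i → count (R<? i) (upTo n)) (upTo n))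
  ∎
  where
  open ≡-Reasoning
  R<? : ∀ i j → Dec _
  R<? i j = (i <? j) ×-dec ¬? (part (r ∸ 1) i ≟ part (r ∸ 1) j)
  E? : (e : Fin n × Fin n) → Dec _
  E? (i , j) = R<? (toℕ i) (toℕ j)
  row : ∀ i → count E? (map (i ,_) (allFin n)) ≡ count (R<? (toℕ i)) (upTo n)
  row i = begin
    count E? (map (i ,_) (allFin n))              ≡⟨ count-map E? (i ,_) (allFin n) ⟩
    count (λ j → R<? (toℕ i) (toℕ j)) (allFin n) ≡⟨ count-map (R<? (toℕ i)) toℕ (allFin n) ⟨
    count (R<? (toℕ i)) (map toℕ (allFin n))     ≡⟨ cong (count (R<? (toℕ i))) (map-toℕ-allFin n) ⟩
    count (R<? (toℕ i)) (upTo n)                 ∎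

scaled-closed-form : ∀ {m} E q a b → a + b ≡ m →
  E + (m * q * q + 2 * a * q + a) ≡ (q * m + a) * (q * m + a) →
  m * E + (q * m + a) * (q * m + a) + a * b ≡ m * ((q * m + a) * (q * m + a))
scaled-closed-form E q a b refl closed = trans (expand E q a b) (cong ((a + b) *_) closed)
  where
  expand : ∀ E q a b → (a + b) * E + (q * (a + b) + a) * (q * (a + b) + a) + a * b
                     ≡ (a + b) * (E + ((a + b) * q * q + 2 * a * q + a))
  expand = solve-∀

defect-identity : ∀ {m} a₁ a₂ {b₁ b₂} c →
                  a₁ + b₁ ≡ m → a₂ + b₂ ≡ m → a₁ + a₂ + c ≡ m →
                  a₁ * b₁ + a₂ * b₂ ≡ (a₁ + a₂) * c + 2 * (a₁ * a₂)
defect-identity a₁ a₂ {b₁} {b₂} c h₁ h₂ refl =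
  substituted (+-cancelˡ-≡ a₁ b₁ (a₂ + c) (trans h₁ (+-assoc a₁ a₂ c)))
              (+-cancelˡ-≡ a₂ b₂ (a₁ + c) (trans h₂ (regroup a₁ a₂ c)))
  where
  regroup : ∀ a₁ a₂ c → a₁ + a₂ + c ≡ a₂ + (a₁ + c)
  regroup = solve-∀
  expand : ∀ a₁ a₂ c → a₁ * (a₂ + c) + a₂ * (a₁ + c) ≡ (a₁ + a₂) * c + 2 * (a₁ * a₂)
  expand = solve-∀
  substituted : b₁ ≡ a₂ + c → b₂ ≡ a₁ + c →
                a₁ * b₁ + a₂ * b₂ ≡ (a₁ + a₂) * c + 2 * (a₁ * a₂)
  substituted refl refl = expand a₁ a₂ c

wrapped-complement : ∀ {m} a₁ a₂ {b₁ b₂ c} →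
                     a₁ + b₁ ≡ m → a₂ + b₂ ≡ m → c + m ≡ a₁ + a₂ → b₁ + b₂ + c ≡ m
wrapped-complement {m} a₁ a₂ {b₁} {b₂} {c} h₁ h₂ wrap = +-cancelʳ-≡ m _ _ (begin
  b₁ + b₂ + c + m         ≡⟨ +-assoc (b₁ + b₂) c m ⟩
  b₁ + b₂ + (c + m)       ≡⟨ cong (b₁ + b₂ +_) wrap ⟩
  b₁ + b₂ + (a₁ + a₂)     ≡⟨ regroup b₁ b₂ a₁ a₂ ⟩
  (a₁ + b₁) + (a₂ + b₂)   ≡⟨ cong₂ _+_ h₁ h₂ ⟩
  m + m                   ∎)
  where
  open ≡-Reasoning
  regroup : ∀ b₁ b₂ a₁ a₂ → b₁ + b₂ + (a₁ + a₂) ≡ (a₁ + b₁) + (a₂ + b₂)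
  regroup = solve-∀

quadratic-defect : ∀ k (F g : ℕ → ℕ) n₁ n₂ X →
  (∀ n → suc k * F n + n * n + g n ≡ suc k * (n * n)) →
  g n₁ + g n₂ ≡ g (n₁ + n₂) + 2 * X →
  suc k * F (n₁ + n₂) ≡ suc k * F n₁ + suc k * F n₂ + 2 * k * (n₁ * n₂) + 2 * X
quadratic-defect k F g n₁ n₂ X F-formula defect = +-cancelʳ-≡ (N * N + g N) _ _ (begin
    suc k * F N + (N * N + g N)
  ≡⟨ trans (sym (+-assoc (suc k * F N) _ _)) (F-formula N) ⟩
    suc k * (N * N)
  ≡⟨ square-of-sum k n₁ n₂ ⟩
    suc k * (n₁ * n₁) + suc k * (n₂ * n₂) + 2 * suc k * (n₁ * n₂)
  ≡⟨ cong₂ (λ x y → x + y + 2 * suc k * (n₁ * n₂)) (sym (F-formula n₁)) (sym (F-formula n₂)) ⟩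
    suc k * F n₁ + n₁ * n₁ + g n₁ + (suc k * F n₂ + n₂ * n₂ + g n₂) + 2 * suc k * (n₁ * n₂)
  ≡⟨ regroup k (F n₁) (F n₂) n₁ n₂ (g n₁) (g n₂) ⟩
    S + N * N + (g n₁ + g n₂)
  ≡⟨ cong (S + N * N +_) defect ⟩
    S + N * N + (g N + 2 * X)
  ≡⟨ regroup′ S (N * N) (g N) (2 * X) ⟩
    S + 2 * X + (N * N + g N)
  ∎)
  where
  open ≡-Reasoning
  N = n₁ + n₂
  S = suc k * F n₁ + suc k * F n₂ + 2 * k * (n₁ * n₂)
  square-of-sum : ∀ k n₁ n₂ → suc k * ((n₁ + n₂) * (n₁ + n₂))
                            ≡ suc k * (n₁ * n₁) + suc k * (n₂ * n₂) + 2 * suc k * (n₁ * n₂)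
  square-of-sum = solve-∀
  regroup : ∀ k F₁ F₂ n₁ n₂ g₁ g₂ →
    suc k * F₁ + n₁ * n₁ + g₁ + (suc k * F₂ + n₂ * n₂ + g₂) + 2 * suc k * (n₁ * n₂)
    ≡ suc k * F₁ + suc k * F₂ + 2 * k * (n₁ * n₂) + (n₁ + n₂) * (n₁ + n₂) + (g₁ + g₂)
  regroup = solve-∀
  regroup′ : ∀ s t g x → s + t + (g + x) ≡ s + x + (t + g)
  regroup′ = solve-∀

module Residues (m : ℕ) .{{_ : NonZero m}} where

  hasResidue? : ∀ c j → Dec (j % m ≡ c)
  hasResidue? c j = j % m ≟ c

  %-periodic : ∀ q j → (q * m + j) % m ≡ j % m
  %-periodic q j = trans (cong (_% m) (+-comm (q * m) j)) ([m+kn]%n≡m%n j q m)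

  [q*m+a]%m≡a : ∀ q {a} → a < m → (q * m + a) % m ≡ a
  [q*m+a]%m≡a q {a} a<m = trans (%-periodic q a) (m<n⇒m%n≡m a<m)

  count-residue-+ : ∀ c q n → count (hasResidue? c) (upTo (q * m + n))
                              ≡ count (hasResidue? c) (upTo (q * m)) + count (hasResidue? c) (upTo n)
  count-residue-+ c q n = begin
      count (hasResidue? c) (upTo (q * m + n))
    ≡⟨ cong (count (hasResidue? c)) (upTo-+ (q * m) n) ⟩
      count (hasResidue? c) (upTo (q * m) ++ map (q * m +_) (upTo n))
    ≡⟨ count-++ (hasResidue? c) (upTo (q * m)) _ ⟩
      count (hasResidue? c) (upTo (q * m)) + count (hasResidue? c) (map (q * m +_) (upTo n))
    ≡⟨ cong (count (hasResidue? c) (upTo (q * m)) +_) (trans (count-map (hasResidue? c) (q * m +_) (upTo n))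
         (count-cong _ _ (applyUpTo⁺₂ id n shift-invariant))) ⟩
      count (hasResidue? c) (upTo (q * m)) + count (hasResidue? c) (upTo n)
    ∎
    where
    open ≡-Reasoning
    shift-invariant : ∀ j → (q * m + j) % m ≡ c ⇔ j % m ≡ c
    shift-invariant j = mk⇔ (trans (sym (%-periodic q j))) (trans (%-periodic q j))

  count-residue-upTo-m : ∀ {c} → c < m → count (hasResidue? c) (upTo m) ≡ 1
  count-residue-upTo-m {c} c<m =
    trans (count-cong _ _ (applyUpTo⁺₁ id m residue-is-self)) (count-≟-upTo c<m)
    where
    residue-is-self : ∀ {j} → j < m → j % m ≡ c ⇔ j ≡ c
    residue-is-self j<m = mk⇔ (trans (sym (m<n⇒m%n≡m j<m))) (trans (m<n⇒m%n≡m j<m))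

  count-residue-* : ∀ {c} → c < m → ∀ q → count (hasResidue? c) (upTo (q * m)) ≡ q
  count-residue-* c<m zero        = refl
  count-residue-* {c} c<m (suc q) = begin
      count (hasResidue? c) (upTo (m + q * m))
    ≡⟨ cong (count (hasResidue? c) ∘′ upTo) (+-comm m (q * m)) ⟩
      count (hasResidue? c) (upTo (q * m + m))
    ≡⟨ count-residue-+ c q m ⟩
      count (hasResidue? c) (upTo (q * m)) + count (hasResidue? c) (upTo m)
    ≡⟨ cong₂ _+_ (count-residue-* c<m q) (count-residue-upTo-m c<m) ⟩
      q + 1
    ≡⟨ +-comm q 1 ⟩
      suc q
    ∎
    where open ≡-Reasoning

  count-residue : ∀ q {a} → a < m → count (hasResidue? a) (upTo (q * m + a)) ≡ q
  count-residue q {a} a<m = begin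
      count (hasResidue? a) (upTo (q * m + a))
    ≡⟨ count-residue-+ a q a ⟩
      count (hasResidue? a) (upTo (q * m)) + count (hasResidue? a) (upTo a)
    ≡⟨ cong₂ _+_ (count-residue-* a<m q) (count-none (hasResidue? a) (applyUpTo⁺₁ id a j%m≢a)) ⟩
      q + 0
    ≡⟨ +-identityʳ q ⟩
      q
    ∎
    where
    open ≡-Reasoning
    j%m≢a : ∀ {j} → j < a → j % m ≢ a
    j%m≢a j<a = <⇒≢ (subst (_< a) (sym (m<n⇒m%n≡m (<-trans j<a a<m))) j<a)

  edgeCount : ℕ → ℕ
  edgeCount = countPairs< (λ i j → ¬? (i % m ≟ j % m))

  edgeCount-suc : ∀ n → edgeCount (suc n) + count (hasResidue? (n % m)) (upTo n) ≡ edgeCount n + n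
  edgeCount-suc n = begin
      edgeCount (suc n) + count (hasResidue? (n % m)) (upTo n)
    ≡⟨ cong (_+ count (hasResidue? (n % m)) (upTo n)) (countPairs<-suc _ n) ⟩
      edgeCount n + count (¬? ∘ hasResidue? (n % m)) (upTo n) + count (hasResidue? (n % m)) (upTo n)
    ≡⟨ +-assoc (edgeCount n) _ _ ⟩
      edgeCount n + (count (¬? ∘ hasResidue? (n % m)) (upTo n) + count (hasResidue? (n % m)) (upTo n))
    ≡⟨ cong (edgeCount n +_) (count-∁+count≡length (hasResidue? (n % m)) (upTo n)) ⟩
      edgeCount n + length (upTo n)
    ≡⟨ cong (edgeCount n +_) (length-applyUpTo id n) ⟩
      edgeCount n + n
    ∎
    where open ≡-Reasoning

  edgeCount-step : ∀ q {a} → a < m →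
                   edgeCount (suc (q * m + a)) + q ≡ edgeCount (q * m + a) + (q * m + a)
  edgeCount-step q {a} a<m = begin
      edgeCount (suc n) + q
    ≡⟨ cong (edgeCount (suc n) +_) (count-residue q a<m) ⟨
      edgeCount (suc n) + count (hasResidue? a) (upTo n)
    ≡⟨ cong (λ c → edgeCount (suc n) + count (hasResidue? c) (upTo n)) ([q*m+a]%m≡a q a<m) ⟨
      edgeCount (suc n) + count (hasResidue? (n % m)) (upTo n)
    ≡⟨ edgeCount-suc n ⟩
      edgeCount n + n
    ∎
    where
    open ≡-Reasoning
    n = q * m + a

  -- m q² + 2 a q + a = a (q + 1)² + (m - a) q² is the number of ordered
  -- pairs of vertices lying in a common class.
  edgeCount-closed-form : ∀ q a → a ≤ m →
    2 * edgeCount (q * m + a) + (m * q * q + 2 * a * q + a) ≡ (q * m + a) * (q * m + a)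
  edgeCount-closed-form zero    zero    _ rewrite *-zeroʳ m = refl
  edgeCount-closed-form (suc q) zero    _ = begin
      2 * edgeCount (suc q * m + 0) + (m * suc q * suc q + 2 * 0 * suc q + 0)
    ≡⟨ cong₂ (λ n s → 2 * edgeCount n + s) n≡ (regroup m q) ⟩
      2 * edgeCount (q * m + m) + (m * q * q + 2 * m * q + m)
    ≡⟨ edgeCount-closed-form q m ≤-refl ⟩
      (q * m + m) * (q * m + m)
    ≡⟨ cong (λ n → n * n) n≡ ⟨
      (suc q * m + 0) * (suc q * m + 0)
    ∎
    where
    open ≡-Reasoning
    n≡ : suc q * m + 0 ≡ q * m + m
    n≡ = trans (+-identityʳ _) (+-comm m (q * m))
    regroup : ∀ m q → m * suc q * suc q + 2 * 0 * suc q + 0 ≡ m * q * q + 2 * m * q + m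
    regroup = solve-∀
  edgeCount-closed-form q (suc a) 1+a≤m = begin
      2 * edgeCount (q * m + suc a) + (m * q * q + 2 * suc a * q + suc a)
    ≡⟨ cong (λ n → 2 * edgeCount n + (m * q * q + 2 * suc a * q + suc a)) (+-suc (q * m) a) ⟩
      2 * edgeCount (suc n) + (m * q * q + 2 * suc a * q + suc a)
    ≡⟨ regroup (edgeCount (suc n)) m q a ⟩
      2 * (edgeCount (suc n) + q) + (m * q * q + 2 * a * q + a) + 1
    ≡⟨ cong (λ e → 2 * e + (m * q * q + 2 * a * q + a) + 1) (edgeCount-step q 1+a≤m) ⟩
      2 * (edgeCount n + n) + (m * q * q + 2 * a * q + a) + 1
    ≡⟨ regroup′ (edgeCount n) n (m * q * q + 2 * a * q + a) ⟩
      2 * edgeCount n + (m * q * q + 2 * a * q + a) + 2 * n + 1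
    ≡⟨ cong (λ s → s + 2 * n + 1) (edgeCount-closed-form q a (<⇒≤ 1+a≤m)) ⟩
      n * n + 2 * n + 1
    ≡⟨ square-suc n ⟩
      suc n * suc n
    ≡⟨ cong (λ n → n * n) (+-suc (q * m) a) ⟨
      (q * m + suc a) * (q * m + suc a)
    ∎
    where
    open ≡-Reasoning
    n = q * m + a
    regroup : ∀ E m q a → 2 * E + (m * q * q + 2 * suc a * q + suc a)
                        ≡ 2 * (E + q) + (m * q * q + 2 * a * q + a) + 1
    regroup = solve-∀
    regroup′ : ∀ E n s → 2 * (E + n) + s + 1 ≡ 2 * E + s + 2 * n + 1
    regroup′ = solve-∀
    square-suc : ∀ n → n * n + 2 * n + 1 ≡ suc n * suc n
    square-suc = solve-∀

  deficit : ℕ → ℕ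
  deficit n = n % m * (m ∸ n % m)

  residue+complement : ∀ n → n % m + (m ∸ n % m) ≡ m
  residue+complement n = m+[n∸m]≡n (<⇒≤ (m%n<n n m))

  edgeCount-deficit : ∀ n → m * (2 * edgeCount n) + n * n + deficit n ≡ m * (n * n)
  edgeCount-deficit n =
    subst (λ x → m * (2 * edgeCount x) + x * x + deficit n ≡ m * (x * x)) (sym n≡q*m+a)
    (scaled-closed-form _ (n ℕ./ m) (n % m) (m ∸ n % m) (residue+complement n)
      (edgeCount-closed-form (n ℕ./ m) (n % m) (<⇒≤ (m%n<n n m))))
    where
    n≡q*m+a : n ≡ n ℕ./ m * m + n % m
    n≡q*m+a = trans (m≡m%n+[m/n]*n n m) (+-comm (n % m) _)

  %-+-unwrapped : ∀ n₁ n₂ → n₁ % m + n₂ % m < m → (n₁ + n₂) % m ≡ n₁ % m + n₂ % m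
  %-+-unwrapped n₁ n₂ small = trans (%-distribˡ-+ n₁ n₂ m) (m<n⇒m%n≡m small)

  %-+-wrapped : ∀ n₁ n₂ → m ≤ n₁ % m + n₂ % m → (n₁ + n₂) % m + m ≡ n₁ % m + n₂ % m
  %-+-wrapped n₁ n₂ large = begin
      (n₁ + n₂) % m + m       ≡⟨ cong (_+ m) (%-distribˡ-+ n₁ n₂ m) ⟩
      s % m + m               ≡⟨ cong (λ x → x % m + m) (m∸n+n≡m large) ⟨
      (s ∸ m + m) % m + m     ≡⟨ cong (_+ m) ([m+n]%n≡m%n (s ∸ m) m) ⟩
      (s ∸ m) % m + m         ≡⟨ cong (_+ m) (m<n⇒m%n≡m s∸m<m) ⟩
      s ∸ m + m               ≡⟨ m∸n+n≡m large ⟩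
      s                       ∎
    where
    open ≡-Reasoning
    s = n₁ % m + n₂ % m
    s∸m<m : s ∸ m < m
    s∸m<m = m<n+o⇒m∸n<o s m (+-mono-< (m%n<n n₁ m) (m%n<n n₂ m))

  deficit-< : ∀ n₁ n₂ → n₁ % m + n₂ % m < m →
              deficit n₁ + deficit n₂ ≡ deficit (n₁ + n₂) + 2 * (n₁ % m * (n₂ % m))
  deficit-< n₁ n₂ small = begin
      deficit n₁ + deficit n₂
    ≡⟨ defect-identity a₁ a₂ (m ∸ (a₁ + a₂)) (residue+complement n₁) (residue+complement n₂)
                                               (m+[n∸m]≡n (<⇒≤ small)) ⟩
      (a₁ + a₂) * (m ∸ (a₁ + a₂)) + 2 * (a₁ * a₂)
    ≡⟨ cong (λ a → a * (m ∸ a) + 2 * (a₁ * a₂)) (%-+-unwrapped n₁ n₂ small) ⟨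
      deficit (n₁ + n₂) + 2 * (a₁ * a₂)
    ∎
    where
    open ≡-Reasoning
    a₁ = n₁ % m
    a₂ = n₂ % m

  deficit-≥ : ∀ n₁ n₂ → m ≤ n₁ % m + n₂ % m →
              deficit n₁ + deficit n₂ ≡ deficit (n₁ + n₂) + 2 * ((m ∸ n₁ % m) * (m ∸ n₂ % m))
  deficit-≥ n₁ n₂ large = begin
      a₁ * b₁ + a₂ * b₂
    ≡⟨ cong₂ _+_ (*-comm a₁ b₁) (*-comm a₂ b₂) ⟩
      b₁ * a₁ + b₂ * a₂
    ≡⟨ defect-identity b₁ b₂ a₁₂ (trans (+-comm b₁ a₁) (residue+complement n₁))
                                  (trans (+-comm b₂ a₂) (residue+complement n₂)) b₁+b₂+a₁₂≡m ⟩
      (b₁ + b₂) * a₁₂ + 2 * (b₁ * b₂)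
    ≡⟨ cong (λ b → b * a₁₂ + 2 * (b₁ * b₂)) b₁+b₂≡b₁₂ ⟩
      (m ∸ a₁₂) * a₁₂ + 2 * (b₁ * b₂)
    ≡⟨ cong (_+ 2 * (b₁ * b₂)) (*-comm (m ∸ a₁₂) a₁₂) ⟩
      a₁₂ * (m ∸ a₁₂) + 2 * (b₁ * b₂)
    ∎
    where
    open ≡-Reasoning
    a₁ = n₁ % m
    a₂ = n₂ % m
    b₁ = m ∸ a₁
    b₂ = m ∸ a₂
    a₁₂ = (n₁ + n₂) % m
    b₁+b₂+a₁₂≡m : b₁ + b₂ + a₁₂ ≡ m
    b₁+b₂+a₁₂≡m = wrapped-complement a₁ a₂ (residue+complement n₁) (residue+complement n₂)
                                           (%-+-wrapped n₁ n₂ large)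
    b₁+b₂≡b₁₂ : b₁ + b₂ ≡ m ∸ a₁₂
    b₁+b₂≡b₁₂ = +-cancelˡ-≡ a₁₂ _ _
      (trans (+-comm a₁₂ (b₁ + b₂)) (trans b₁+b₂+a₁₂≡m (sym (residue+complement (n₁ + n₂)))))

-- Opened only here: with the prefix `+_` in scope, sections such as
-- `(n +_)` above would be ambiguous.
open import Data.Integer.Base using (+_)

fromℕ : ℕ → ℚ
fromℕ n = + n / 1

toℚᵘ-/ : ∀ x d → toℚᵘ (+ x / suc d) ≃ᵘ mkℚᵘ (+ x) d
toℚᵘ-/ x d = toℚᵘ-fromℚᵘ (mkℚᵘ (+ x) d)

fromℕ-+ : ∀ x y → fromℕ (x + y) ≡ fromℕ x +ℚ fromℕ y
fromℕ-+ x y = toℚᵘ-injective (begin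
  toℚᵘ (fromℕ (x + y))               ≈⟨ toℚᵘ-/ (x + y) 0 ⟩
  mkℚᵘ (+ (x + y)) 0                 ≈⟨ *≡* (eq (+ x) (+ y)) ⟩
  mkℚᵘ (+ x) 0 +ᵘ mkℚᵘ (+ y) 0       ≈⟨ +ᵘ-cong (toℚᵘ-/ x 0) (toℚᵘ-/ y 0) ⟨
  toℚᵘ (fromℕ x) +ᵘ toℚᵘ (fromℕ y)   ≈⟨ toℚᵘ-homo-+ (fromℕ x) (fromℕ y) ⟨
  toℚᵘ (fromℕ x +ℚ fromℕ y)          ∎)
  where
  open ≃-Reasoning
  eq : ∀ i j → (i ℤ.+ j) ℤ.* + 1 ≡ (i ℤ.* + 1 ℤ.+ j ℤ.* + 1) ℤ.* + 1
  eq = ℤ-Solver.solve-∀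

fromℕ-* : ∀ x y → fromℕ (x * y) ≡ fromℕ x *ℚ fromℕ y
fromℕ-* x y = toℚᵘ-injective (begin
  toℚᵘ (fromℕ (x * y))               ≈⟨ toℚᵘ-/ (x * y) 0 ⟩
  mkℚᵘ (+ (x * y)) 0                 ≈⟨ *≡* (cong (ℤ._* + 1) (pos-* x y)) ⟩
  mkℚᵘ (+ x) 0 *ᵘ mkℚᵘ (+ y) 0       ≈⟨ *ᵘ-cong (toℚᵘ-/ x 0) (toℚᵘ-/ y 0) ⟨
  toℚᵘ (fromℕ x) *ᵘ toℚᵘ (fromℕ y)   ≈⟨ toℚᵘ-homo-* (fromℕ x) (fromℕ y) ⟨
  toℚᵘ (fromℕ x *ℚ fromℕ y)          ∎)
  where open ≃-Reasoning

/-as-* : ∀ x d → + x / suc d ≡ fromℕ x *ℚ (+ 1 / suc d)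
/-as-* x d = toℚᵘ-injective (begin
  toℚᵘ (+ x / suc d)                         ≈⟨ toℚᵘ-/ x d ⟩
  mkℚᵘ (+ x) d                               ≈⟨ *≡* eq ⟩
  mkℚᵘ (+ x) 0 *ᵘ mkℚᵘ (+ 1) d               ≈⟨ *ᵘ-cong (toℚᵘ-/ x 0) (toℚᵘ-/ 1 d) ⟨
  toℚᵘ (fromℕ x) *ᵘ toℚᵘ (+ 1 / suc d)       ≈⟨ toℚᵘ-homo-* (fromℕ x) (+ 1 / suc d) ⟨
  toℚᵘ (fromℕ x *ℚ (+ 1 / suc d))            ∎)
  where
  open ≃-Reasoning
  eq : + x ℤ.* + suc (d + 0) ≡ (+ x ℤ.* + 1) ℤ.* + suc d
  eq = trans (cong (λ e → + x ℤ.* + suc e) (+-identityʳ d))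
             (cong (ℤ._* + suc d) (sym (ℤ-*-identityʳ (+ x))))

fromℕ≡*/ : ∀ x d → fromℕ x ≡ fromℕ (suc d * x) *ℚ (+ 1 / suc d)
fromℕ≡*/ x d = toℚᵘ-injective (let open ≃-Reasoning in begin
  toℚᵘ (fromℕ x)                                 ≈⟨ toℚᵘ-/ x 0 ⟩
  mkℚᵘ (+ x) 0                                   ≈⟨ *≡* eq ⟩
  mkℚᵘ (+ (suc d * x)) 0 *ᵘ mkℚᵘ (+ 1) d         ≈⟨ *ᵘ-cong (toℚᵘ-/ (suc d * x) 0) (toℚᵘ-/ 1 d) ⟨
  toℚᵘ (fromℕ (suc d * x)) *ᵘ toℚᵘ (+ 1 / suc d) ≈⟨ toℚᵘ-homo-* (fromℕ (suc d * x)) (+ 1 / suc d) ⟨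
  toℚᵘ (fromℕ (suc d * x) *ℚ (+ 1 / suc d))      ∎)
  where
  eq : + x ℤ.* + suc (d + 0) ≡ (+ (suc d * x) ℤ.* + 1) ℤ.* + 1
  eq = begin
    + x ℤ.* + suc (d + 0)             ≡⟨ cong (λ e → + x ℤ.* + suc e) (+-identityʳ d) ⟩
    + x ℤ.* + suc d                   ≡⟨ pos-* x (suc d) ⟨
    + (x * suc d)                     ≡⟨ cong +_ (*-comm x (suc d)) ⟩
    + (suc d * x)                     ≡⟨ ℤ-*-identityʳ _ ⟨
    + (suc d * x) ℤ.* + 1             ≡⟨ ℤ-*-identityʳ _ ⟨
    (+ (suc d * x) ℤ.* + 1) ℤ.* + 1   ∎
    where open ≡-Reasoning

-- Without a zero test the solver cannot discard cancelled monomials.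
ℚ-ring : AlmostCommutativeRing 0ℓ 0ℓ
ℚ-ring = fromCommutativeRing +-*-commutativeRing (λ x → dec⇒maybe (0ℚ ≟ℚ x))

ℚ-cancel : ∀ a b t κ p x u →
  (a +ℚ b +ℚ t *ℚ κ *ℚ p +ℚ t *ℚ x) *ℚ u - a *ℚ u - b *ℚ u - t *ℚ (κ *ℚ u) *ℚ p
  ≡ t *ℚ (x *ℚ u)
ℚ-cancel = ℚ-Solver.solve-∀ ℚ-ring

divide-by-suc : ∀ k F₁₂ F₁ F₂ P X →
  suc k * F₁₂ ≡ suc k * F₁ + suc k * F₂ + 2 * k * P + 2 * X →
  fromℕ F₁₂ - fromℕ F₁ - fromℕ F₂ - fromℕ 2 *ℚ (+ k / suc k) *ℚ fromℕ P
  ≡ fromℕ 2 *ℚ (+ X / suc k)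
divide-by-suc k F₁₂ F₁ F₂ P X eq = begin
    fromℕ F₁₂ - fromℕ F₁ - fromℕ F₂ - fromℕ 2 *ℚ (+ k / suc k) *ℚ fromℕ P
  ≡⟨ cong₂ _-_ (cong₂ _-_ (cong₂ _-_ (fromℕ≡*/ F₁₂ k) (fromℕ≡*/ F₁ k)) (fromℕ≡*/ F₂ k))
               (cong (λ c → fromℕ 2 *ℚ c *ℚ fromℕ P) (/-as-* k k)) ⟩
    fromℕ (m * F₁₂) *ℚ u - mF₁ *ℚ u - mF₂ *ℚ u - fromℕ 2 *ℚ (fromℕ k *ℚ u) *ℚ fromℕ P
  ≡⟨ cong (λ c → c *ℚ u - mF₁ *ℚ u - mF₂ *ℚ u - fromℕ 2 *ℚ (fromℕ k *ℚ u) *ℚ fromℕ P)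
          (trans (cong fromℕ eq) expand) ⟩
    (mF₁ +ℚ mF₂ +ℚ fromℕ 2 *ℚ fromℕ k *ℚ fromℕ P +ℚ fromℕ 2 *ℚ fromℕ X) *ℚ u
      - mF₁ *ℚ u - mF₂ *ℚ u - fromℕ 2 *ℚ (fromℕ k *ℚ u) *ℚ fromℕ P
  ≡⟨ ℚ-cancel mF₁ mF₂ (fromℕ 2) (fromℕ k) (fromℕ P) (fromℕ X) u ⟩
    fromℕ 2 *ℚ (fromℕ X *ℚ u)
  ≡⟨ cong (fromℕ 2 *ℚ_) (/-as-* X k) ⟨
    fromℕ 2 *ℚ (+ X / suc k)
  ∎
  where
  open ≡-Reasoning
  m = suc k
  u = + 1 / suc k
  mF₁ = fromℕ (m * F₁)
  mF₂ = fromℕ (m * F₂)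
  expand : fromℕ (m * F₁ + m * F₂ + 2 * k * P + 2 * X)
         ≡ mF₁ +ℚ mF₂ +ℚ fromℕ 2 *ℚ fromℕ k *ℚ fromℕ P +ℚ fromℕ 2 *ℚ fromℕ X
  expand = trans (fromℕ-+ (m * F₁ + m * F₂ + 2 * k * P) (2 * X)) (cong₂ _+ℚ_
    (trans (fromℕ-+ (m * F₁ + m * F₂) (2 * k * P))
      (cong₂ _+ℚ_ (fromℕ-+ (m * F₁) (m * F₂))
                  (trans (fromℕ-* (2 * k) P) (cong (_*ℚ fromℕ P) (fromℕ-* 2 k)))))
    (fromℕ-* 2 X))

proposition2p2 : (n₁ n₂ r : ℕ) → (hr : 2 ≤ r) →
    let instance _ = r∸1-nonZero hr in
    let α₁ = n₁ % (r ∸ 1) in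
    let α₂ = n₂ % (r ∸ 1) in
    let lhs = (+ f (n₁ + n₂) r / 1) - (+ f n₁ r / 1) - (+ f n₂ r / 1)
              - (+ 2 / 1) *ℚ (+ (r ∸ 2) / (r ∸ 1)) *ℚ (+ (n₁ * n₂) / 1) in
    (α₁ + α₂ < r ∸ 1 → lhs ≡ (+ 2 / 1) *ℚ (+ (α₁ * α₂) / (r ∸ 1)))
    × (r ∸ 1 ≤ α₁ + α₂ → lhs ≡ (+ 2 / 1) *ℚ (+ ((r ∸ 1 ∸ α₁) * (r ∸ 1 ∸ α₂)) / (r ∸ 1)))
proposition2p2 n₁ n₂ (suc (suc k)) (s≤s (s≤s z≤n)) =
    (λ small → divided-defect (n₁ % suc k * (n₂ % suc k)) (deficit-< n₁ n₂ small))
  , (λ large → divided-defect ((suc k ∸ n₁ % suc k) * (suc k ∸ n₂ % suc k)) (deficit-≥ n₁ n₂ large))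
  where
  open Residues (suc k)
  F : ℕ → ℕ
  F n = f n (2 + k)
  F-deficit : ∀ n → suc k * F n + n * n + deficit n ≡ suc k * (n * n)
  F-deficit n = subst (λ e → suc k * (2 * e) + n * n + deficit n ≡ suc k * (n * n))
                      (sym (length-TuranEdges n (2 + k))) (edgeCount-deficit n)
  divided-defect : ∀ X → deficit n₁ + deficit n₂ ≡ deficit (n₁ + n₂) + 2 * X →
    fromℕ (F (n₁ + n₂)) - fromℕ (F n₁) - fromℕ (F n₂)
      - fromℕ 2 *ℚ (+ k / suc k) *ℚ fromℕ (n₁ * n₂)
    ≡ fromℕ 2 *ℚ (+ X / suc k)
  divided-defect X defect = divide-by-suc k (F (n₁ + n₂)) (F n₁) (F n₂) (n₁ * n₂) X
    (quadratic-defect k F deficit n₁ n₂ X F-deficit defect)
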